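{- Let $D_1=(V_1,A_1)$ be a Steiner rooted $k$-arc-connected $3$-regular directed graph with root $r\in V_1$ and terminal set $S=\{s_1,s_2\}\subseteq V_1\setminus\{r\}$. Suppose a vertex $v\in V_1\setminus(S\cup\{r\})$ has two incident arcs $e$ and $f$ which are either both entering $v$ or both leaving $v$, such that $e$ leaves some tight $s_1$-cut and $f$ leaves some tight $s_2$-cut. Let $D_2=(V_2,A_2)$ be an $(S\cup\{r\})$-fixed directed topological minor of $D_1$ with corresponding map $\psi\colon V_2\to V_1$ and paths $\{P_e:e\in A_2\}$, and suppose $D_2$ is a Steiner rooted $k$-arc-connected $3$-regular directed graph (with root $r$ and terminal set $S$). Then $v$ is in the image of $\psi$.
   Context: Directed graphs are loopless and may have parallel arcs. With root $r$ and terminal set $S$, a directed graph is Steiner rooted $k$-arc-connected if for every $s\in S$ there are $k$ pairwise arc-disjoint directed $r$-$s$ paths; it is $3$-regular (w.r.t. $k$) if $r$ has in-degree $0$ and out-degree $k$, each terminal has in-degree $k$ and out-degree $0$, and every other vertex has in-degree plus out-degree $3$. For $s\in S$, an $s$-cut is $U\subseteq V_1$ with $r\in U$, $s\notin U$; it is tight if exactly $k$ arcs leave $U$. An arc leaves $U$ if its tail is in $U$ and its head is not. For $W\subseteq V_1\cap V_2$, $D_2$ is a $W$-fixed directed topological minor of $D_1$ if there is an injective $\psi\colon V_2\to V_1$ with $\psi(w)=w$ for $w\in W$ and pairwise internally vertex-disjoint directed paths $P_e$ in $D_1$ ($e\in A_2$), where for $e=uv$, $P_e$ goes from $\psi(u)$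 to $\psi(v)$ and has no internal vertex in $W$. -}

module Defs where

open import Data.Nat using (ℕ; _+_)
open import Data.Fin using (Fin; _≟_)
open import Data.Bool using (Bool; true; false; _∧_; not)
open import Data.List using (List; []; _∷_; length; filter; filterᵇ; allFin)
open import Data.List.Membership.Propositional using (_∈_)
open import Data.List.Relation.Unary.Unique.Propositional using (Unique)
open import Data.Product using (Σ; ∃; ∃-syntax; _×_; _,_)
open import Data.Sum using (_⊎_)
open import Relation.Nullary using (¬_)
open import Relation.Nullary.Decidable using (⌊_⌋)
open import Relation.Binary.PropositionalEquality using (_≡_; _≢_)
open import Function.Definitions using (Injective)

-- A finite loopless directed multigraph: vertices Fin n, arcs Fin m
-- (parallel arcs allowed, since arcs are indexed independently).
record Digraph : Set where
  field
    n m      : ℕ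
    tail head : Fin m → Fin n
    loopless : ∀ a → tail a ≢ head a

module _ (D : Digraph) where
  open Digraph D

  V A : Set
  V = Fin n
  A = Fin m

  data Walk : V → V → Set where
    []  : ∀ {u} → Walk u u
    _∷_ : ∀ {w} (a : A) → Walk (head a) w → Walk (tail a) w

  verts : ∀ {u w} → Walk u w → List V
  verts {u} [] = u ∷ []
  verts (a ∷ p) = tail a ∷ verts p

  arcs : ∀ {u w} → Walk u w → List A
  arcs [] = []
  arcs (a ∷ p) = a ∷ arcs p

  vertsInit : ∀ {u w} → Walk u w → List V
  vertsInit [] = []
  vertsInit (a ∷ p) = tail a ∷ vertsInit p

  -- internal vertices (all except first and last)
  inner : ∀ {u w} → Walk u w → List V
  inner [] = []
  inner (a ∷ p) = vertsInit p

  record Path (u w : V) : Set where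
    constructor path
    field
      walk   : Walk u w
      simple : Unique (verts walk)
  open Path public

  ArcDisjointPaths : ℕ → V → V → Set
  ArcDisjointPaths k u w =
    Σ (Fin k → Path u w) λ P →
      ∀ i j (a : A) → a ∈ arcs (walk (P i)) → a ∈ arcs (walk (P j)) → i ≡ j

  SteinerRootedArcConn : ℕ → V → V → V → Set
  SteinerRootedArcConn k r t₁ t₂ =
    ArcDisjointPaths k r t₁ × ArcDisjointPaths k r t₂

  indeg outdeg : V → ℕ
  indeg v  = length (filter (λ a → head a ≟ v) (allFin m))
  outdeg v = length (filter (λ a → tail a ≟ v) (allFin m))

  ThreeRegular : ℕ → V → V → V → Set
  ThreeRegular k r t₁ t₂ =
    (indeg r ≡ 0 × outdeg r ≡ k)
    × (indeg t₁ ≡ k × outdeg t₁ ≡ 0)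
    × (indeg t₂ ≡ k × outdeg t₂ ≡ 0)
    × (∀ v → v ≢ r → v ≢ t₁ → v ≢ t₂ → indeg v + outdeg v ≡ 3)

  -- vertex sets U ⊆ V as Boolean predicates
  Leaves : (V → Bool) → A → Set
  Leaves U a = U (tail a) ≡ true × U (head a) ≡ false

  leavingArcs : (V → Bool) → List A
  leavingArcs U = filterᵇ (λ a → U (tail a) ∧ not (U (head a))) (allFin m)

  IsCut : V → V → (V → Bool) → Set
  IsCut r s U = U r ≡ true × U s ≡ false

  IsTightCut : ℕ → V → V → (V → Bool) → Set
  IsTightCut k r s U = IsCut r s U × length (leavingArcs U) ≡ k

  LeavesTightCut : ℕ → V → V → A → Set
  LeavesTightCut k r s a = ∃[ U ] (IsTightCut k r s U × Leaves U a)

open Digraph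

record FixedTopMinor (D₁ D₂ : Digraph) (r s₁ s₂ : V D₁) (r' t₁ t₂ : V D₂)
       (ψ : V D₂ → V D₁) : Set where
  field
    ψ-inj : Injective _≡_ _≡_ ψ
    ψ-r   : ψ r' ≡ r
    ψ-s₁  : ψ t₁ ≡ s₁
    ψ-s₂  : ψ t₂ ≡ s₂
    P     : (e : A D₂) → Path D₁ (ψ (tail D₂ e)) (ψ (head D₂ e))
    indep : ∀ e e' → e ≢ e' → ∀ x → x ∈ inner D₁ (walk (P e))
              → ¬ (x ∈ verts D₁ (walk (P e')))
    avoidW : ∀ e x → x ∈ inner D₁ (walk (P e)) → x ≢ r × x ≢ s₁ × x ≢ s₂

{-# OPTIONS --safe #-}
module Submission where

-- Call the paths P g branch paths and the ψ u branch vertices. Each of the k arc-disjoint r'–t₁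
-- paths of D₂ expands to an r–s₁ walk of D₁, which leaves the tight s₁-cut along an arc of some
-- branch path. Two of these paths cannot leave along the same arc: that arc would lie on two
-- branch paths, making their D₂-arcs parallel, and 3-regularity forbids parallel arcs on distinct
-- arc-disjoint paths (a common tail other than r', or a common head other than t₁, would have in-
-- and out-degree 2, while two arcs r'→t₁ together with the first arcs of the k r'–t₂ paths exceed
-- the out-degree k of r'). So these are all k arcs leaving the cut, e is one of them, and
-- likewise f lies on a branch path. If v were not a branch vertex, it would be an inner vertex of
-- both branch paths; by internal disjointness they coincide, and then e ≠ f would be two arcs of
-- one path both entering, or both leaving, v.

open import Defs
open import Data.Nat using (ℕ; zero; suc; _+_; _≤_)
open import Data.Nat.Properties using (+-mono-≤; ≤⇒≯; n≤1+n; 1+n≰n; n≮n)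
open import Data.Fin using (Fin; zero; suc; _≟_)
open import Data.Fin.Properties using (injective⇒≤; any?)
open import Data.Bool using (Bool; true; false; _∧_; not; T)
open import Data.Unit using (tt)
open import Data.List using (List; length; filter; allFin; lookup)
open import Data.List.Membership.Propositional using (_∈_)
open import Data.List.Membership.Propositional.Properties using (∈-filter⁺; ∈-allFin)
open import Data.List.Relation.Unary.Any using (here; there; index)
open import Data.List.Relation.Unary.Any.Properties using (lookup-index)
open import Data.List.Relation.Unary.All as All using ()
open import Data.List.Relation.Unary.AllPairs using (_∷_)
open import Data.List.Relation.Unary.Unique.Propositional using (Unique)
open import Data.Vec.Functional as Vector using (Vector)
open import Data.Product as Product using (∃-syntax; _×_; _,_; proj₁; proj₂)
open import Data.Sum as Sum using (_⊎_; inj₁; inj₂)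
open import Data.Empty using (⊥; ⊥-elim)
open import Function using (_∘_)
open import Function.Definitions using (Injective)
open import Relation.Nullary using (yes; no; contradiction)
open import Relation.Unary using (Pred; Decidable)
open import Relation.Binary.PropositionalEquality
  using (_≡_; _≢_; refl; sym; trans; cong; subst; module ≡-Reasoning)

open Digraph

[]-injective : ∀ {b} {B : Set b} → Injective _≡_ _≡_ (Vector.[] {A = B})
[]-injective {x = ()}

∷-injective : ∀ {b} {B : Set b} {n} {x : B} {f : Vector B n}
  → Injective _≡_ _≡_ f → (∀ i → f i ≢ x) → Injective _≡_ _≡_ (x Vector.∷ f)
∷-injective f-inj x∉f {zero}  {zero}  _  = refl
∷-injective f-inj x∉f {zero}  {suc j} eq = contradiction (sym eq) (x∉f j)
∷-injective f-inj x∉f {suc i} {zero}  eq = contradiction eq (x∉f i)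
∷-injective f-inj x∉f {suc i} {suc j} eq = cong suc (f-inj eq)

distinct-pair-injective : ∀ {b} {B : Set b} {x y : B} → x ≢ y
  → Injective _≡_ _≡_ (x Vector.∷ y Vector.∷ Vector.[])
distinct-pair-injective x≢y = ∷-injective (∷-injective []-injective λ ()) λ { zero → x≢y ∘ sym }

injective⇒≤-count : ∀ {m n p} {P : Pred (Fin m) p} (P? : Decidable P) {f : Vector (Fin m) n}
  → Injective _≡_ _≡_ f → (∀ i → P (f i)) → n ≤ length (filter P? (allFin m))
injective⇒≤-count {m} P? {f} f-inj Pf = injective⇒≤ {f = index ∘ f∈} position-injective
  where
  L : List (Fin m)
  L = filter P? (allFin m)
  f∈ : ∀ i → f i ∈ L
  f∈ i = ∈-filter⁺ P? (∈-allFin (f i)) (Pf i)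
  position-injective : Injective _≡_ _≡_ (index ∘ f∈)
  position-injective {i} {j} eq = f-inj (begin
    f i                     ≡⟨ lookup-index (f∈ i) ⟩
    lookup L (index (f∈ i)) ≡⟨ cong (lookup L) eq ⟩
    lookup L (index (f∈ j)) ≡⟨ lookup-index (f∈ j) ⟨
    f j                     ∎)
    where open ≡-Reasoning

injective⇒≤-leavingArcs : ∀ (D : Digraph) {U n} {f : Vector (A D) n}
  → Injective _≡_ _≡_ f → (∀ i → Leaves D U (f i)) → n ≤ length (leavingArcs D U)
injective⇒≤-leavingArcs D {U} f-inj f-leaves = injective⇒≤-count _ f-inj (leaves⇒T ∘ f-leaves)
  where
  leaves⇒T : ∀ {a} → Leaves D U a → T (U (tail D a) ∧ not (U (head D a)))
  leaves⇒T (tail∈U , head∉U) rewrite tail∈U | head∉U = tt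

module WalkProperties (D : Digraph) where

  start∈verts : ∀ {u w} (p : Walk D u w) → u ∈ verts D p
  start∈verts []      = here refl
  start∈verts (_ ∷ _) = here refl

  start≡end-or∈vertsInit : ∀ {u w} (p : Walk D u w) → u ≡ w ⊎ u ∈ vertsInit D p
  start≡end-or∈vertsInit []      = inj₁ refl
  start≡end-or∈vertsInit (_ ∷ _) = inj₂ (here refl)

  vertsInit⊆verts : ∀ {u w x} (p : Walk D u w) → x ∈ vertsInit D p → x ∈ verts D p
  vertsInit⊆verts (_ ∷ _) (here refl) = here refl
  vertsInit⊆verts (_ ∷ p) (there x∈)  = there (vertsInit⊆verts p x∈)

  inner⊆vertsInit : ∀ {u w x} (p : Walk D u w) → x ∈ inner D p → x ∈ vertsInit D p
  inner⊆vertsInit (_ ∷ _) x∈ = there x∈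

  inner⊆verts : ∀ {u w x} (p : Walk D u w) → x ∈ inner D p → x ∈ verts D p
  inner⊆verts p = vertsInit⊆verts p ∘ inner⊆vertsInit p

  tail∈vertsInit : ∀ {u w a} (p : Walk D u w) → a ∈ arcs D p → tail D a ∈ vertsInit D p
  tail∈vertsInit (_ ∷ _) (here refl) = here refl
  tail∈vertsInit (_ ∷ p) (there a∈)  = there (tail∈vertsInit p a∈)

  tail∈verts : ∀ {u w a} (p : Walk D u w) → a ∈ arcs D p → tail D a ∈ verts D p
  tail∈verts p = vertsInit⊆verts p ∘ tail∈vertsInit p

  head∈verts : ∀ {u w a} (p : Walk D u w) → a ∈ arcs D p → head D a ∈ verts D p
  head∈verts (_ ∷ p) (here refl) = there (start∈verts p)
  head∈verts (_ ∷ p) (there a∈)  = there (head∈verts p a∈)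

  vertsInit-start-or-inner : ∀ {u w x} (p : Walk D u w) → x ∈ vertsInit D p
    → x ≡ u ⊎ x ∈ inner D p
  vertsInit-start-or-inner (_ ∷ _) (here refl) = inj₁ refl
  vertsInit-start-or-inner (_ ∷ _) (there x∈)  = inj₂ x∈

  tail-start-or-inner : ∀ {u w a} (p : Walk D u w) → a ∈ arcs D p
    → tail D a ≡ u ⊎ tail D a ∈ inner D p
  tail-start-or-inner p = vertsInit-start-or-inner p ∘ tail∈vertsInit p

  head-end-or-inner : ∀ {u w a} (p : Walk D u w) → a ∈ arcs D p
    → head D a ≡ w ⊎ head D a ∈ inner D p
  head-end-or-inner (_ ∷ p) (here refl) = start≡end-or∈vertsInit p
  head-end-or-inner (_ ∷ p) (there a∈)  = Sum.map₂ (inner⊆vertsInit p) (head-end-or-inner p a∈)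

  inner-entered : ∀ {u w x} (p : Walk D u w) → x ∈ inner D p
    → ∃[ c ] c ∈ arcs D p × head D c ≡ x
  inner-entered (c ∷ p) x∈ with vertsInit-start-or-inner p x∈
  ... | inj₁ refl     = c , here refl , refl
  ... | inj₂ x∈inner = Product.map₂ (Product.map₁ there) (inner-entered p x∈inner)

  vertsInit-left : ∀ {u w x} (p : Walk D u w) → x ∈ vertsInit D p
    → ∃[ d ] d ∈ arcs D p × tail D d ≡ x
  vertsInit-left (d ∷ _) (here refl) = d , here refl , refl
  vertsInit-left (_ ∷ p) (there x∈)  = Product.map₂ (Product.map₁ there) (vertsInit-left p x∈)

  inner-left : ∀ {u w x} (p : Walk D u w) → x ∈ inner D p
    → ∃[ d ] d ∈ arcs D p × tail D d ≡ x
  inner-left p = vertsInit-left p ∘ inner⊆vertsInit p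

  first-arc : ∀ {u w} (p : Walk D u w) → u ≢ w → ∃[ c ] c ∈ arcs D p × tail D c ≡ u
  first-arc []      u≢w = contradiction refl u≢w
  first-arc (c ∷ _) _   = c , here refl , refl

  leaving-arc : (U : V D → Bool) → ∀ {u w} (p : Walk D u w) → U u ≡ true → U w ≡ false
    → ∃[ a ] a ∈ arcs D p × Leaves D U a
  leaving-arc U []      u∈U w∉U = contradiction (trans (sym u∈U) w∉U) λ ()
  leaving-arc U (c ∷ p) u∈U w∉U with U (head D c) in head-c∈U
  ... | false = c , here refl , u∈U , head-c∈U
  ... | true  = Product.map₂ (Product.map₁ there) (leaving-arc U p head-c∈U w∉U)

  head≢start : ∀ {u w b} (p : Walk D u w) → Unique (verts D p) → b ∈ arcs D p → head D b ≢ u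
  head≢start (_ ∷ p) (c∉p ∷ _) (here refl) eq = All.lookup c∉p (start∈verts p) (sym eq)
  head≢start (_ ∷ p) (c∉p ∷ _) (there b∈)  eq = All.lookup c∉p (head∈verts p b∈) (sym eq)

  head-injective : ∀ {u w a b} (p : Walk D u w) → Unique (verts D p)
    → a ∈ arcs D p → b ∈ arcs D p → head D a ≡ head D b → a ≡ b
  head-injective (_ ∷ _) _           (here refl) (here refl) _  = refl
  head-injective (_ ∷ p) (_ ∷ p-uniq) (here refl) (there b∈)  eq =
    contradiction (sym eq) (head≢start p p-uniq b∈)
  head-injective (_ ∷ p) (_ ∷ p-uniq) (there a∈)  (here refl) eq =
    contradiction eq (head≢start p p-uniq a∈)
  head-injective (_ ∷ p) (_ ∷ p-uniq) (there a∈)  (there b∈)  eq = head-injective p p-uniq a∈ b∈ eq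

  tail-injective : ∀ {u w a b} (p : Walk D u w) → Unique (verts D p)
    → a ∈ arcs D p → b ∈ arcs D p → tail D a ≡ tail D b → a ≡ b
  tail-injective (_ ∷ _) _           (here refl) (here refl) _  = refl
  tail-injective (_ ∷ p) (c∉p ∷ _)    (here refl) (there b∈)  eq =
    contradiction eq (All.lookup c∉p (tail∈verts p b∈))
  tail-injective (_ ∷ p) (c∉p ∷ _)    (there a∈)  (here refl) eq =
    contradiction (sym eq) (All.lookup c∉p (tail∈verts p a∈))
  tail-injective (_ ∷ p) (_ ∷ p-uniq) (there a∈)  (there b∈)  eq = tail-injective p p-uniq a∈ b∈ eq

module Degrees (D : Digraph) where

  outdeg≡0⇒no-out-arc : ∀ {x a} → outdeg D x ≡ 0 → tail D a ≢ x
  outdeg≡0⇒no-out-arc {x} {a} outdeg≡0 tail≡x = contradiction (subst (1 ≤_) outdeg≡0 1≤outdeg) λ ()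
    where
    1≤outdeg : 1 ≤ outdeg D x
    1≤outdeg = injective⇒≤-count (λ b → tail D b ≟ x) (∷-injective []-injective λ ()) λ { zero → tail≡x }

  two-in-arcs⇒2≤indeg : ∀ {x a b} → a ≢ b → head D a ≡ x → head D b ≡ x → 2 ≤ indeg D x
  two-in-arcs⇒2≤indeg {x} a≢b ha hb =
    injective⇒≤-count (λ c → head D c ≟ x) (distinct-pair-injective a≢b) λ { zero → ha ; (suc zero) → hb }

  two-out-arcs⇒2≤outdeg : ∀ {x a b} → a ≢ b → tail D a ≡ x → tail D b ≡ x → 2 ≤ outdeg D x
  two-out-arcs⇒2≤outdeg {x} a≢b ta tb =
    injective⇒≤-count (λ c → tail D c ≟ x) (distinct-pair-injective a≢b) λ { zero → ta ; (suc zero) → tb }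

ThreeRegular-swap : ∀ D {k r t t'} → ThreeRegular D k r t t' → ThreeRegular D k r t' t
ThreeRegular-swap _ (root , terminal , terminal' , deg≡3) =
  root , terminal' , terminal , λ x x≢r x≢t' x≢t → deg≡3 x x≢r x≢t x≢t'

module ThreeRegularDigraph (D : Digraph) {k r t t'} (regular : ThreeRegular D k r t t') where
  open Degrees D
  open WalkProperties D

  private
    indeg-r≡0 : indeg D r ≡ 0
    indeg-r≡0 = proj₁ (proj₁ regular)
    outdeg-r≡k : outdeg D r ≡ k
    outdeg-r≡k = proj₂ (proj₁ regular)
    outdeg-t≡0 : outdeg D t ≡ 0
    outdeg-t≡0 = proj₂ (proj₁ (proj₂ regular))
    outdeg-t'≡0 : outdeg D t' ≡ 0
    outdeg-t'≡0 = proj₂ (proj₁ (proj₂ (proj₂ regular)))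
    deg≡3 : ∀ x → x ≢ r → x ≢ t → x ≢ t' → indeg D x + outdeg D x ≡ 3
    deg≡3 = proj₂ (proj₂ (proj₂ regular))

  no-vertex-with-2-in-2-out : ∀ {x} → 2 ≤ indeg D x → 2 ≤ outdeg D x → ⊥
  no-vertex-with-2-in-2-out {x} 2≤in 2≤out with x ≟ r | x ≟ t | x ≟ t'
  ... | yes refl | _ | _ = contradiction (subst (2 ≤_) indeg-r≡0 2≤in) λ ()
  ... | _ | yes refl | _ = contradiction (subst (2 ≤_) outdeg-t≡0 2≤out) λ ()
  ... | _ | _ | yes refl = contradiction (subst (2 ≤_) outdeg-t'≡0 2≤out) λ ()
  ... | no x≢r | no x≢t | no x≢t' = n≮n 3 (subst (4 ≤_) (deg≡3 x x≢r x≢t x≢t') (+-mono-≤ 2≤in 2≤out))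

  module DisjointPathFamilies (t≢t' : t ≢ t') (r≢t' : r ≢ t')
           (Q : ArcDisjointPaths D k r t) (R : ArcDisjointPaths D k r t') where

    Q[_] : Fin k → Walk D r t
    Q[ i ] = walk (proj₁ Q i)

    R[_] : Fin k → Walk D r t'
    R[ l ] = walk (proj₁ R l)

    Q-disjoint : ∀ {i j a b} → i ≢ j → a ∈ arcs D Q[ i ] → b ∈ arcs D Q[ j ] → a ≢ b
    Q-disjoint i≢j a∈ b∈ refl = i≢j (proj₂ Q _ _ _ a∈ b∈)

    R-avoids-t : ∀ l {c} → c ∈ arcs D R[ l ] → head D c ≢ t
    R-avoids-t l c∈ head≡t with head-end-or-inner R[ l ] c∈
    ... | inj₁ head≡t' = t≢t' (trans (sym head≡t) head≡t')
    ... | inj₂ inner   =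
      let _ , _ , tail≡head = inner-left R[ l ] inner
      in outdeg≡0⇒no-out-arc outdeg-t≡0 (trans tail≡head head≡t)

    no-two-arcs-root→t : ∀ {g g'} → g ≢ g' → tail D g ≡ r → tail D g' ≡ r
      → head D g ≡ t → head D g' ≡ t → ⊥
    no-two-arcs-root→t {g} {g'} g≢g' tg tg' hg hg' =
      ≤⇒≯ (subst (2 + k ≤_) outdeg-r≡k (injective⇒≤-count _ out-arcs-injective out-arcs-tail))
          (n≤1+n (suc k))
      where
      R-first : Fin k → A D
      R-first l = proj₁ (first-arc R[ l ] r≢t')
      R-first∈ : ∀ l → R-first l ∈ arcs D R[ l ]
      R-first∈ l = proj₁ (proj₂ (first-arc R[ l ] r≢t'))
      R-first-injective : Injective _≡_ _≡_ R-first
      R-first-injective {l} {l'} eq =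
        proj₂ R l l' _ (R-first∈ l) (subst (λ c → c ∈ arcs D R[ l' ]) (sym eq) (R-first∈ l'))
      R-first≢ : ∀ {c} → head D c ≡ t → ∀ l → R-first l ≢ c
      R-first≢ head≡t l refl = R-avoids-t l (R-first∈ l) head≡t
      out-arcs : Vector (A D) (2 + k)
      out-arcs = g Vector.∷ g' Vector.∷ R-first
      out-arcs-injective : Injective _≡_ _≡_ out-arcs
      out-arcs-injective = ∷-injective (∷-injective R-first-injective (R-first≢ hg'))
        λ { zero → g≢g' ∘ sym ; (suc l) → R-first≢ hg l }
      out-arcs-tail : ∀ i → tail D (out-arcs i) ≡ r
      out-arcs-tail zero = tg
      out-arcs-tail (suc zero) = tg'
      out-arcs-tail (suc (suc l)) = proj₂ (proj₂ (first-arc R[ l ] r≢t'))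

    shared-tail≡root : ∀ {i j g g'} → i ≢ j → g ∈ arcs D Q[ i ] → g' ∈ arcs D Q[ j ]
      → tail D g ≡ tail D g' → tail D g ≡ r
    shared-tail≡root i≢j g∈ g'∈ same with tail-start-or-inner Q[ _ ] g∈ | tail-start-or-inner Q[ _ ] g'∈
    ... | inj₁ tail≡r | _ = tail≡r
    ... | _ | inj₁ tail'≡r = trans same tail'≡r
    ... | inj₂ inner | inj₂ inner' =
      let c , c∈ , hc = inner-entered Q[ _ ] inner
          c' , c'∈ , hc' = inner-entered Q[ _ ] inner'
      in ⊥-elim (no-vertex-with-2-in-2-out
           (two-in-arcs⇒2≤indeg (Q-disjoint i≢j c∈ c'∈) hc (trans hc' (sym same)))
           (two-out-arcs⇒2≤outdeg (Q-disjoint i≢j g∈ g'∈) refl (sym same)))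

    shared-head≡t : ∀ {i j g g'} → i ≢ j → g ∈ arcs D Q[ i ] → g' ∈ arcs D Q[ j ]
      → head D g ≡ head D g' → head D g ≡ t
    shared-head≡t i≢j g∈ g'∈ same with head-end-or-inner Q[ _ ] g∈ | head-end-or-inner Q[ _ ] g'∈
    ... | inj₁ head≡t | _ = head≡t
    ... | _ | inj₁ head'≡t = trans same head'≡t
    ... | inj₂ inner | inj₂ inner' =
      let d , d∈ , td = inner-left Q[ _ ] inner
          d' , d'∈ , td' = inner-left Q[ _ ] inner'
      in ⊥-elim (no-vertex-with-2-in-2-out
           (two-in-arcs⇒2≤indeg (Q-disjoint i≢j g∈ g'∈) refl (sym same))
           (two-out-arcs⇒2≤outdeg (Q-disjoint i≢j d∈ d'∈) td (trans td' (sym same))))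

    no-parallel-arcs-on-distinct-paths : ∀ {i j g g'} → i ≢ j → g ∈ arcs D Q[ i ] → g' ∈ arcs D Q[ j ]
      → tail D g ≡ tail D g' × head D g ≡ head D g' → ⊥
    no-parallel-arcs-on-distinct-paths {g = g} i≢j g∈ g'∈ (same-tail , same-head) =
      no-two-arcs-root→t (Q-disjoint i≢j g∈ g'∈)
        tail≡r (trans (sym same-tail) tail≡r) head≡t (trans (sym same-head) head≡t)
      where
      tail≡r : tail D g ≡ r
      tail≡r = shared-tail≡root i≢j g∈ g'∈ same-tail
      head≡t : head D g ≡ t
      head≡t = shared-head≡t i≢j g∈ g'∈ same-head

FixedTopMinor-swap : ∀ {D₁ D₂ r s₁ s₂ r' t₁ t₂ ψ} → FixedTopMinor D₁ D₂ r s₁ s₂ r' t₁ t₂ ψ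
  → FixedTopMinor D₁ D₂ r s₂ s₁ r' t₂ t₁ ψ
FixedTopMinor-swap M = record
  { ψ-inj  = ψ-inj
  ; ψ-r    = ψ-r
  ; ψ-s₁   = ψ-s₂
  ; ψ-s₂   = ψ-s₁
  ; P      = P
  ; indep  = indep
  ; avoidW = λ e x x∈ → let x≢r , x≢s₁ , x≢s₂ = avoidW e x x∈ in x≢r , x≢s₂ , x≢s₁
  }
  where open FixedTopMinor M

module BranchPaths {D₁ D₂ r s₁ s₂ r' t₁ t₂ ψ} (M : FixedTopMinor D₁ D₂ r s₁ s₂ r' t₁ t₂ ψ) where
  open FixedTopMinor M
  open WalkProperties D₁

  branch : (g : A D₂) → Walk D₁ (ψ (tail D₂ g)) (ψ (head D₂ g))
  branch g = walk (P g)

  ψ-reflects-≢ : ∀ {x y a b} → ψ x ≡ a → ψ y ≡ b → a ≢ b → x ≢ y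
  ψ-reflects-≢ ψx≡a ψy≡b a≢b refl = a≢b (trans (sym ψx≡a) ψy≡b)

  shared-inner⇒same-branch : ∀ {x g h} → x ∈ inner D₁ (branch g) → x ∈ inner D₁ (branch h) → g ≡ h
  shared-inner⇒same-branch {x} {g} {h} x∈g x∈h with g ≟ h
  ... | yes g≡h = g≡h
  ... | no g≢h  = contradiction (inner⊆verts (branch h) x∈h) (indep g h g≢h x x∈g)

  shared-arc-tail≡start : ∀ {a g g'} → g ≢ g' → a ∈ arcs D₁ (branch g) → a ∈ arcs D₁ (branch g')
    → tail D₁ a ≡ ψ (tail D₂ g)
  shared-arc-tail≡start {a} {g} {g'} g≢g' a∈g a∈g' with tail-start-or-inner (branch g) a∈g
  ... | inj₁ tail≡start = tail≡start
  ... | inj₂ inner      = contradiction (tail∈verts (branch g') a∈g') (indep g g' g≢g' _ inner)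

  shared-arc-head≡end : ∀ {a g g'} → g ≢ g' → a ∈ arcs D₁ (branch g) → a ∈ arcs D₁ (branch g')
    → head D₁ a ≡ ψ (head D₂ g)
  shared-arc-head≡end {a} {g} {g'} g≢g' a∈g a∈g' with head-end-or-inner (branch g) a∈g
  ... | inj₁ head≡end = head≡end
  ... | inj₂ inner    = contradiction (head∈verts (branch g') a∈g') (indep g g' g≢g' _ inner)

  shared-arc⇒parallel : ∀ {a g g'} → g ≢ g' → a ∈ arcs D₁ (branch g) → a ∈ arcs D₁ (branch g')
    → tail D₂ g ≡ tail D₂ g' × head D₂ g ≡ head D₂ g'
  shared-arc⇒parallel g≢g' a∈g a∈g' =
    ψ-inj (trans (sym (shared-arc-tail≡start g≢g' a∈g a∈g'))
                 (shared-arc-tail≡start (g≢g' ∘ sym) a∈g' a∈g)) ,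
    ψ-inj (trans (sym (shared-arc-head≡end g≢g' a∈g a∈g'))
                 (shared-arc-head≡end (g≢g' ∘ sym) a∈g' a∈g))

  record BranchCrossing (U : V D₁ → Bool) {x y} (w : Walk D₂ x y) : Set where
    constructor crossing
    field
      arc₂        : A D₂
      arc₂∈w      : arc₂ ∈ arcs D₂ w
      arc₁        : A D₁
      arc₁∈branch : arc₁ ∈ arcs D₁ (branch arc₂)
      arc₁-leaves : Leaves D₁ U arc₁

  branch-crossing : (U : V D₁ → Bool) → ∀ {x y} (w : Walk D₂ x y) → U (ψ x) ≡ true → U (ψ y) ≡ false
    → BranchCrossing U w
  branch-crossing U []      x∈U y∉U = contradiction (trans (sym x∈U) y∉U) λ ()
  branch-crossing U (g ∷ w) x∈U y∉U with U (ψ (head D₂ g)) in head-g∈U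
  ... | false = let a , a∈ , a-leaves = leaving-arc U (branch g) x∈U head-g∈U
                in crossing g (here refl) a a∈ a-leaves
  ... | true with branch-crossing U w head-g∈U y∉U
  ...   | crossing g' g'∈w a a∈ a-leaves = crossing g' (there g'∈w) a a∈ a-leaves

  module _ {k} (Q : ArcDisjointPaths D₂ k r' t₁) (R : ArcDisjointPaths D₂ k r' t₂)
           (regular : ThreeRegular D₂ k r' t₁ t₂) (r≢s₂ : r ≢ s₂) (s₁≢s₂ : s₁ ≢ s₂)
           {U : V D₁ → Bool} (U-cut : IsCut D₁ r s₁ U) where
    open ThreeRegularDigraph.DisjointPathFamilies D₂ regular
           (ψ-reflects-≢ ψ-s₁ ψ-s₂ s₁≢s₂) (ψ-reflects-≢ ψ-r ψ-s₂ r≢s₂) Q R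
    open BranchCrossing

    Q-crossing : (i : Fin k) → BranchCrossing U Q[ i ]
    Q-crossing i = branch-crossing U Q[ i ] (subst (λ x → U x ≡ true) (sym ψ-r) (proj₁ U-cut))
                                            (subst (λ x → U x ≡ false) (sym ψ-s₁) (proj₂ U-cut))

    Q-crossing-arc : Fin k → A D₁
    Q-crossing-arc i = arc₁ (Q-crossing i)

    Q-crossing-arc-injective : Injective _≡_ _≡_ Q-crossing-arc
    Q-crossing-arc-injective {i} {j} same-arc with i ≟ j
    ... | yes i≡j = i≡j
    ... | no i≢j  = ⊥-elim (no-parallel-arcs-on-distinct-paths i≢j (arc₂∈w cᵢ) (arc₂∈w cⱼ)
            (shared-arc⇒parallel (Q-disjoint i≢j (arc₂∈w cᵢ) (arc₂∈w cⱼ))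
              (arc₁∈branch cᵢ)
              (subst (λ a → a ∈ arcs D₁ (branch (arc₂ cⱼ))) (sym same-arc) (arc₁∈branch cⱼ))))
      where
      cᵢ : BranchCrossing U Q[ i ]
      cᵢ = Q-crossing i
      cⱼ : BranchCrossing U Q[ j ]
      cⱼ = Q-crossing j

    tight-cut-leaving-arc-on-branch : length (leavingArcs D₁ U) ≡ k → ∀ {a} → Leaves D₁ U a
      → ∃[ g ] a ∈ arcs D₁ (branch g)
    tight-cut-leaving-arc-on-branch tight {a} a-leaves with any? (λ i → Q-crossing-arc i ≟ a)
    ... | yes (i , refl) = arc₂ (Q-crossing i) , arc₁∈branch (Q-crossing i)
    ... | no a-new = contradiction (subst (suc k ≤_) tight
            (injective⇒≤-leavingArcs D₁ {U}
              (∷-injective Q-crossing-arc-injective λ i eq → a-new (i , eq))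
              λ { zero → a-leaves ; (suc i) → arc₁-leaves (Q-crossing i) }))
          1+n≰n

  arc-leaving-tight-cut-on-branch : ∀ {k} → SteinerRootedArcConn D₂ k r' t₁ t₂ → ThreeRegular D₂ k r' t₁ t₂
    → r ≢ s₂ → s₁ ≢ s₂ → ∀ {a} → LeavesTightCut D₁ k r s₁ a → ∃[ g ] a ∈ arcs D₁ (branch g)
  arc-leaving-tight-cut-on-branch (Q , R) regular r≢s₂ s₁≢s₂ (U , (U-cut , tight) , a-leaves) =
    tight-cut-leaving-arc-on-branch Q R regular r≢s₂ s₁≢s₂ U-cut tight a-leaves

  common-head∈image : ∀ {e f g h} → e ≢ f → e ∈ arcs D₁ (branch g) → f ∈ arcs D₁ (branch h)
    → head D₁ e ≡ head D₁ f → ∃[ u ] ψ u ≡ head D₁ e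
  common-head∈image {g = g} {h = h} e≢f e∈g f∈h same
    with head-end-or-inner (branch g) e∈g | head-end-or-inner (branch h) f∈h
  ... | inj₁ e-end | _ = head D₂ g , sym e-end
  ... | _ | inj₁ f-end = head D₂ h , sym (trans same f-end)
  ... | inj₂ e-inner | inj₂ f-inner
    with shared-inner⇒same-branch e-inner (subst (λ x → x ∈ inner D₁ (branch h)) (sym same) f-inner)
  ... | refl = contradiction (head-injective (branch g) (simple (P g)) e∈g f∈h same) e≢f

  common-tail∈image : ∀ {e f g h} → e ≢ f → e ∈ arcs D₁ (branch g) → f ∈ arcs D₁ (branch h)
    → tail D₁ e ≡ tail D₁ f → ∃[ u ] ψ u ≡ tail D₁ e
  common-tail∈image {g = g} {h = h} e≢f e∈g f∈h same
    with tail-start-or-inner (branch g) e∈g | tail-start-or-inner (branch h) f∈h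
  ... | inj₁ e-start | _ = tail D₂ g , sym e-start
  ... | _ | inj₁ f-start = tail D₂ h , sym (trans same f-start)
  ... | inj₂ e-inner | inj₂ f-inner
    with shared-inner⇒same-branch e-inner (subst (λ x → x ∈ inner D₁ (branch h)) (sym same) f-inner)
  ... | refl = contradiction (tail-injective (branch g) (simple (P g)) e∈g f∈h same) e≢f

  common-endpoint∈image : ∀ {e f g h v} → e ≢ f → e ∈ arcs D₁ (branch g) → f ∈ arcs D₁ (branch h)
    → (head D₁ e ≡ v × head D₁ f ≡ v) ⊎ (tail D₁ e ≡ v × tail D₁ f ≡ v) → ∃[ u ] ψ u ≡ v
  common-endpoint∈image e≢f e∈g f∈h (inj₁ (refl , f-head)) = common-head∈image e≢f e∈g f∈h (sym f-head)
  common-endpoint∈image e≢f e∈g f∈h (inj₂ (refl , f-tail)) = common-tail∈image e≢f e∈g f∈h (sym f-tail)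

lemma2p7 : (k : ℕ) (D₁ : Digraph) (r s₁ s₂ : V D₁)
    → r ≢ s₁ → r ≢ s₂ → s₁ ≢ s₂
    → SteinerRootedArcConn D₁ k r s₁ s₂
    → ThreeRegular D₁ k r s₁ s₂
    → (v : V D₁) → v ≢ r → v ≢ s₁ → v ≢ s₂
    → (e f : A D₁) → e ≢ f
    → ((head D₁ e ≡ v × head D₁ f ≡ v) ⊎ (tail D₁ e ≡ v × tail D₁ f ≡ v))
    → LeavesTightCut D₁ k r s₁ e
    → LeavesTightCut D₁ k r s₂ f
    → (D₂ : Digraph) (r' t₁ t₂ : V D₂) (ψ : V D₂ → V D₁)
    → FixedTopMinor D₁ D₂ r s₁ s₂ r' t₁ t₂ ψ
    → SteinerRootedArcConn D₂ k r' t₁ t₂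
    → ThreeRegular D₂ k r' t₁ t₂
    → ∃[ u ] ψ u ≡ v
lemma2p7 k D₁ r s₁ s₂ r≢s₁ r≢s₂ s₁≢s₂ _ _ v _ _ _ e f e≢f e,f-at-v e-leaves f-leaves
         D₂ r' t₁ t₂ ψ M (Q₁ , Q₂) regular =
  common-endpoint∈image e≢f (proj₂ e-on-branch) (proj₂ f-on-branch) e,f-at-v
  where
  open BranchPaths M

  e-on-branch : ∃[ g ] e ∈ arcs D₁ (branch g)
  e-on-branch = arc-leaving-tight-cut-on-branch (Q₁ , Q₂) regular r≢s₂ s₁≢s₂ e-leaves

  f-on-branch : ∃[ h ] f ∈ arcs D₁ (branch h)
  f-on-branch = BranchPaths.arc-leaving-tight-cut-on-branch (FixedTopMinor-swap M)
    (Q₂ , Q₁) (ThreeRegular-swap D₂ regular) r≢s₁ (s₁≢s₂ ∘ sym) f-leaves
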